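{- Let $c\ge 2$, let $(G,k)$ be an instance of \textsc{$c$-Closed Vertex Deletion}, and let $S$ be a minimum-size set of vertices such that $G-S$ is $c$-closed. Then for every neighborhood class $D$ of $G$, either $D\setminus S=D$ or $|D\setminus S|<c$.
   Context: A graph is $c$-closed if every pair of distinct nonadjacent vertices has at most $c-1$ common neighbors. \textsc{$c$-Closed Vertex Deletion}: given a graph $G=(V,E)$ and a positive integer $k$, decide whether there is $S\subseteq V$ with $|S|\le k$ such that $G-S$ is $c$-closed. The neighborhood classes of $G$ are the equivalence classes of the relation $u\sim v \iff N(u)\setminus\{v\}=N(v)\setminus\{u\}$ on $V(G)$. -}

module Defs where

open import Data.Nat using (ℕ; _<_; _≤_)
open import Data.Bool using (Bool; true; false; _∧_; not)
open import Data.Fin using (Fin)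
open import Data.Fin.Subset using (Subset; _∈_; _∉_; ∣_∣; _∩_; _─_; ∁; ⁅_⁆)
open import Data.Vec using (tabulate)
open import Relation.Binary.PropositionalEquality using (_≡_; _≢_)
open import Relation.Nullary using (¬_)
open import Data.Product using (Σ; _×_)

record Graph (n : ℕ) : Set where
  field
    adj   : Fin n → Fin n → Bool
    sym   : ∀ u v → adj u v ≡ adj v u
    irref : ∀ u → adj u u ≡ false
open Graph public

Adj : ∀ {n} → Graph n → Fin n → Fin n → Set
Adj G u v = adj G u v ≡ true

N : ∀ {n} → Graph n → Fin n → Subset n
N G u = tabulate (adj G u)

commonOutside : ∀ {n} → Graph n → Subset n → Fin n → Fin n → Subset n
commonOutside G S u v = (N G u ∩ N G v) ─ S

ClosedAfterDeletion : ∀ {n} → ℕ → Graph n → Subset n → Set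
ClosedAfterDeletion c G S =
  ∀ u v → u ∉ S → v ∉ S → u ≢ v → ¬ Adj G u v →
  ∣ commonOutside G S u v ∣ < c

MinimumDeletionSet : ∀ {n} → ℕ → Graph n → Subset n → Set
MinimumDeletionSet c G S =
  ClosedAfterDeletion c G S × (∀ S′ → ClosedAfterDeletion c G S′ → ∣ S ∣ ≤ ∣ S′ ∣)

NbEquiv : ∀ {n} → Graph n → Fin n → Fin n → Set
NbEquiv G u v = (N G u ─ ⁅ v ⁆) ≡ (N G v ─ ⁅ u ⁆)

IsNeighborhoodClass : ∀ {n} → Graph n → Subset n → Set
IsNeighborhoodClass {n} G D = Σ (Fin n) λ x → ∀ y → (y ∈ D → NbEquiv G y x) × (NbEquiv G y x → y ∈ D)

-- If some vertex s of a neighborhood class D is deleted while at least c ≥ 2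
-- members of D survive, then s can be put back. Members of D are twins of s,
-- so for a nonadjacent pair {s, v} a surviving twin d ≠ v of s has the same
-- common neighbours with v; and s cannot be a common neighbour of a
-- nonadjacent surviving pair {u, v}: if u or v lay in D it would be adjacent
-- to the other, and otherwise all surviving members of D would be c common
-- neighbours of u and v. Hence a minimum deletion set never meets D in this way.
module Submission where

open import Defs
open import Data.Nat using (ℕ; _≤_; _<_; s≤s)
open import Data.Nat.Properties using (≤-trans; ≤-<-trans; <⇒≱; _<?_; ≮⇒≥)
open import Data.Fin using (Fin; zero; suc; _≟_)
open import Data.Fin.Subset
  using (Subset; _∈_; _∉_; _⊆_; ∣_∣; _∩_; _─_; _-_; ⁅_⁆; inside; outside; Empty)
open import Data.Fin.Subset.Properties
open import Data.Vec using (_∷_; lookup; here; there)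
open import Data.Vec.Properties using ([]=⇒lookup; lookup⇒[]=; lookup∘tabulate)
open import Data.Product using (∃; _×_; _,_; proj₁)
open import Data.Sum using (_⊎_; inj₁; inj₂)
open import Function using (_∘_)
open import Relation.Nullary using (¬_; yes; no)
open import Relation.Nullary.Negation using (contradiction)
open import Relation.Binary.PropositionalEquality as ≡ using (_≡_; _≢_; refl; cong; subst)
open ≡.≡-Reasoning

private
  variable
    n : ℕ
    p q : Subset n
    x y : Fin n

x∈p─q⇒x∉q : x ∈ p ─ q → x ∉ q
x∈p─q⇒x∉q {p = _ ∷ _} {outside ∷ _} here         ()
x∈p─q⇒x∉q {p = _ ∷ _} {outside ∷ _} (there x∈p─q) (there x∈q) = x∈p─q⇒x∉q x∈p─q x∈q
x∈p─q⇒x∉q {p = _ ∷ _} {inside ∷ _}  (there x∈p─q) (there x∈q) = x∈p─q⇒x∉q x∈p─q x∈q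

Empty[p∩q]⇒p─q≡p : Empty (p ∩ q) → p ─ q ≡ p
Empty[p∩q]⇒p─q≡p {p = p} {q} p∩q-empty = ⊆-antisym (p─q⊆p p q) p⊆p─q
  where
  p⊆p─q : p ⊆ p ─ q
  p⊆p─q {x} x∈p = x∈p∧x∉q⇒x∈p─q x∈p (λ x∈q → p∩q-empty (x , x∈p∩q⁺ (x∈p , x∈q)))

x∉p-y∧x≢y⇒x∉p : x ∉ p - y → x ≢ y → x ∉ p
x∉p-y∧x≢y⇒x∉p x∉p-y x≢y x∈p = x∉p-y (x∈p∧x≢y⇒x∈p-y x∈p x≢y)

2≤∣p∣⇒x∈p∧x≢y : 2 ≤ ∣ p ∣ → ∀ y → ∃ λ x → x ∈ p × x ≢ y
2≤∣p∣⇒x∈p∧x≢y {p = p} 2≤∣p∣ y with nonempty? (p - y)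
... | yes (x , x∈p-y) = x , p─q⊆p p ⁅ y ⁆ x∈p-y , x∉⁅y⁆⇒x≢y (x∈p─q⇒x∉q x∈p-y)
... | no p-y-empty =
  contradiction (subst (2 ≤_) (∣⁅x⁆∣≡1 y) (≤-trans 2≤∣p∣ (p⊆q⇒∣p∣≤∣q∣ p⊆⁅y⁆))) λ { (s≤s ()) }
  where
  p⊆⁅y⁆ : p ⊆ ⁅ y ⁆
  p⊆⁅y⁆ {x} x∈p with x ≟ y
  ... | yes refl = x∈⁅x⁆ y
  ... | no x≢y   = contradiction (x , x∈p∧x≢y⇒x∈p-y x∈p x≢y) p-y-empty

lookup-⁅⁆ : x ≢ y → lookup ⁅ y ⁆ x ≡ outside
lookup-⁅⁆ {x = x} {y} x≢y with lookup ⁅ y ⁆ x in eq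
... | outside = refl
... | inside  = contradiction (lookup⇒[]= x ⁅ y ⁆ eq) (x≢y⇒x∉⁅y⁆ x≢y)

lookup-─ : ∀ (p q : Subset n) → lookup q x ≡ outside → lookup (p ─ q) x ≡ lookup p x
lookup-─ {x = zero}  (_ ∷ _) (outside ∷ _) _ = refl
lookup-─ {x = suc x} (_ ∷ p) (_ ∷ q) q[x]≡outside = lookup-─ p q q[x]≡outside

module _ {n} {G : Graph n} where

  Adj-sym : ∀ {u v} → Adj G u v → Adj G v u
  Adj-sym {u} {v} = ≡.trans (Graph.sym G v u)

  Adj⇒≢ : ∀ {u v} → Adj G u v → u ≢ v
  Adj⇒≢ {u} u~u refl = contradiction (≡.trans (≡.sym u~u) (irref G u)) λ ()

  ∈N⇒Adj : ∀ {u w} → w ∈ N G u → Adj G u w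
  ∈N⇒Adj {u} {w} w∈Nu = ≡.trans (≡.sym (lookup∘tabulate (adj G u) w)) ([]=⇒lookup w∈Nu)

  Adj⇒∈N : ∀ {u w} → Adj G u w → w ∈ N G u
  Adj⇒∈N {u} {w} u~w = lookup⇒[]= w (N G u) (≡.trans (lookup∘tabulate (adj G u) w) u~w)

  ∈commonOutside⁻ : ∀ {S u v w} → w ∈ commonOutside G S u v → Adj G u w × Adj G v w × w ∉ S
  ∈commonOutside⁻ {S} {u} {v} w∈common with x∈p∩q⁻ (N G u) (N G v) (p─q⊆p _ S w∈common)
  ... | w∈Nu , w∈Nv = ∈N⇒Adj w∈Nu , ∈N⇒Adj w∈Nv , x∈p─q⇒x∉q w∈common

  ∈commonOutside⁺ : ∀ {S u v w} → Adj G u w → Adj G v w → w ∉ S → w ∈ commonOutside G S u v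
  ∈commonOutside⁺ u~w v~w w∉S = x∈p∧x∉q⇒x∈p─q (x∈p∩q⁺ (Adj⇒∈N u~w , Adj⇒∈N v~w)) w∉S

  commonOutside-comm : ∀ S u v → commonOutside G S u v ≡ commonOutside G S v u
  commonOutside-comm S u v = cong (_─ S) (∩-comm (N G u) (N G v))

  Twins : Fin n → Fin n → Set
  Twins a b = ∀ w → w ≢ a → w ≢ b → adj G a w ≡ adj G b w

  Twins-sym : ∀ {a b} → Twins a b → Twins b a
  Twins-sym a≈b w w≢b w≢a = ≡.sym (a≈b w w≢a w≢b)

  Twins-trans : ∀ {a b d} → Twins a b → Twins b d → Twins a d
  Twins-trans {a} {b} {d} a≈b b≈d w w≢a w≢d with w ≟ b
  ... | no w≢b = ≡.trans (a≈b w w≢a w≢b) (b≈d w w≢b w≢d)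
  ... | yes refl with a ≟ d
  ...   | yes refl = refl
  ...   | no a≢d = begin
    adj G a w  ≡⟨ Graph.sym G a w ⟩
    adj G w a  ≡⟨ b≈d a (w≢a ∘ ≡.sym) a≢d ⟩
    adj G d a  ≡⟨ Graph.sym G d a ⟩
    adj G a d  ≡⟨ a≈b d (a≢d ∘ ≡.sym) (w≢d ∘ ≡.sym) ⟩
    adj G w d  ≡⟨ Graph.sym G w d ⟩
    adj G d w  ∎

  Twins-Adj : ∀ {a b w} → Twins a b → w ≢ a → w ≢ b → Adj G a w → Adj G b w
  Twins-Adj a≈b w≢a w≢b = ≡.trans (≡.sym (a≈b _ w≢a w≢b))

  NbEquiv⇒Twins : ∀ {a b} → NbEquiv G a b → Twins a b
  NbEquiv⇒Twins {a} {b} Na-b≡Nb-a w w≢a w≢b = begin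
    adj G a w                    ≡⟨ lookup∘tabulate (adj G a) w ⟨
    lookup (N G a) w             ≡⟨ lookup-─ (N G a) ⁅ b ⁆ (lookup-⁅⁆ w≢b) ⟨
    lookup (N G a ─ ⁅ b ⁆) w     ≡⟨ cong (λ p → lookup p w) Na-b≡Nb-a ⟩
    lookup (N G b ─ ⁅ a ⁆) w     ≡⟨ lookup-─ (N G b) ⁅ a ⁆ (lookup-⁅⁆ w≢a) ⟩
    lookup (N G b) w             ≡⟨ lookup∘tabulate (adj G b) w ⟩
    adj G b w                    ∎

  IsNeighborhoodClass⇒Twins : ∀ {D a b} → IsNeighborhoodClass G D → a ∈ D → b ∈ D → Twins a b
  IsNeighborhoodClass⇒Twins (x , class) a∈D b∈D =
    Twins-trans (NbEquiv⇒Twins (proj₁ (class _) a∈D))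
                (Twins-sym (NbEquiv⇒Twins (proj₁ (class _) b∈D)))

  commonOutside-twin-⊆ : ∀ {S s d v} → Twins s d → ¬ Adj G d v →
                         commonOutside G (S - s) s v ⊆ commonOutside G S d v
  commonOutside-twin-⊆ {d = d} s≈d ¬d~v w∈common with ∈commonOutside⁻ w∈common
  ... | s~w , v~w , w∉S-s = ∈commonOutside⁺ (Twins-Adj s≈d w≢s w≢d s~w) v~w (x∉p-y∧x≢y⇒x∉p w∉S-s w≢s)
    where
    w≢s = Adj⇒≢ s~w ∘ ≡.sym
    w≢d : _ ≢ d
    w≢d refl = ¬d~v (Adj-sym v~w)

  commonOutside-undelete-⊆ : ∀ {S s u v} → ¬ (Adj G u s × Adj G v s) →
                             commonOutside G (S - s) u v ⊆ commonOutside G S u v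
  commonOutside-undelete-⊆ {s = s} s∉common {w} w∈common with ∈commonOutside⁻ w∈common | w ≟ s
  ... | u~w , v~w , _     | yes refl = contradiction (u~w , v~w) s∉common
  ... | u~w , v~w , w∉S-s | no w≢s   = ∈commonOutside⁺ u~w v~w (x∉p-y∧x≢y⇒x∉p w∉S-s w≢s)

  twins-⊆-commonOutside : ∀ {S s u v T} → (∀ {d} → d ∈ T → d ∉ S) → (∀ {d} → d ∈ T → Twins s d) →
                          u ∉ T → v ∉ T → u ≢ s → v ≢ s → Adj G s u → Adj G s v →
                          T ⊆ commonOutside G S u v
  twins-⊆-commonOutside T∩S≡∅ T-twins u∉T v∉T u≢s v≢s s~u s~v d∈T =
    ∈commonOutside⁺ (Adj-sym (Twins-Adj s≈d u≢s u≢d s~u)) (Adj-sym (Twins-Adj s≈d v≢s v≢d s~v)) (T∩S≡∅ d∈T)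
    where
    s≈d = T-twins d∈T
    u≢d = λ { refl → u∉T d∈T }
    v≢d = λ { refl → v∉T d∈T }

  module _ {c S s T} (2≤c : 2 ≤ c) (c≤∣T∣ : c ≤ ∣ T ∣)
           (T∩S≡∅ : ∀ {d} → d ∈ T → d ∉ S) (T-twins : ∀ {d} → d ∈ T → Twins s d)
           (closed : ClosedAfterDeletion c G S) where

    -- Only the surviving twin d needs to differ from v, whence 2 ≤ c.
    closed-with-undeleted : ∀ v → v ∉ S - s → v ≢ s → ¬ Adj G s v → ∣ commonOutside G (S - s) s v ∣ < c
    closed-with-undeleted v v∉S-s v≢s ¬s~v with 2≤∣p∣⇒x∈p∧x≢y (≤-trans 2≤c c≤∣T∣) v
    ... | d , d∈T , d≢v =
      ≤-<-trans (p⊆q⇒∣p∣≤∣q∣ (commonOutside-twin-⊆ {S = S} (T-twins d∈T) ¬d~v))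
                (closed d v (T∩S≡∅ d∈T) (x∉p-y∧x≢y⇒x∉p v∉S-s v≢s) d≢v ¬d~v)
      where
      ¬d~v : ¬ Adj G d v
      ¬d~v = ¬s~v ∘ Twins-Adj (Twins-sym (T-twins d∈T)) (d≢v ∘ ≡.sym) v≢s

    undeleted-not-common : ∀ {u v} → u ∉ S → v ∉ S → u ≢ s → v ≢ s → u ≢ v → ¬ Adj G u v →
                           ¬ (Adj G u s × Adj G v s)
    undeleted-not-common {u} {v} u∉S v∉S u≢s v≢s u≢v ¬u~v (u~s , v~s) with u ∈? T | v ∈? T
    ... | yes u∈T | _ = ¬u~v (Twins-Adj (T-twins u∈T) v≢s (u≢v ∘ ≡.sym) (Adj-sym v~s))
    ... | no _ | yes v∈T = ¬u~v (Adj-sym (Twins-Adj (T-twins v∈T) u≢s u≢v (Adj-sym u~s)))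
    ... | no u∉T | no v∉T =
      <⇒≱ (closed u v u∉S v∉S u≢v ¬u~v)
          (≤-trans c≤∣T∣ (p⊆q⇒∣p∣≤∣q∣
            (twins-⊆-commonOutside T∩S≡∅ T-twins u∉T v∉T u≢s v≢s (Adj-sym u~s) (Adj-sym v~s))))

    ClosedAfterDeletion-undelete : ClosedAfterDeletion c G (S - s)
    ClosedAfterDeletion-undelete u v u∉S-s v∉S-s u≢v ¬u~v with u ≟ s | v ≟ s
    ... | yes refl | yes refl = contradiction refl u≢v
    ... | yes refl | no v≢s   = closed-with-undeleted v v∉S-s v≢s ¬u~v
    ... | no u≢s   | yes refl =
      subst (λ p → ∣ p ∣ < c) (commonOutside-comm (S - s) v u)
            (closed-with-undeleted u u∉S-s u≢s (¬u~v ∘ Adj-sym))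
    ... | no u≢s   | no v≢s   =
      ≤-<-trans (p⊆q⇒∣p∣≤∣q∣ (commonOutside-undelete-⊆ {S = S} (undeleted-not-common u∉S v∉S u≢s v≢s u≢v ¬u~v)))
                (closed u v u∉S v∉S u≢v ¬u~v)
      where
      u∉S = x∉p-y∧x≢y⇒x∉p u∉S-s u≢s
      v∉S = x∉p-y∧x≢y⇒x∉p v∉S-s v≢s

lemma8 : (c : ℕ) → 2 ≤ c → (n : ℕ) → (G : Graph n) → (S : Subset n) →
         MinimumDeletionSet c G S →
         (D : Subset n) → IsNeighborhoodClass G D →
         ((D ─ S) ≡ D) ⊎ (∣ D ─ S ∣ < c)
lemma8 c 2≤c n G S (closed , minimum) D D-class with nonempty? (D ∩ S)
... | no D∩S-empty = inj₁ (Empty[p∩q]⇒p─q≡p D∩S-empty)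
... | yes (s , s∈D∩S) with x∈p∩q⁻ D S s∈D∩S | ∣ D ─ S ∣ <? c
...   | _ | yes few = inj₂ few
...   | s∈D , s∈S | no many =
  contradiction (minimum (S - s) closed-without-s) (<⇒≱ (x∈p⇒∣p-x∣<∣p∣ s∈S))
  where
  closed-without-s : ClosedAfterDeletion c G (S - s)
  closed-without-s =
    ClosedAfterDeletion-undelete {G = G} {S = S} {s = s} {T = D ─ S} 2≤c (≮⇒≥ many) (x∈p─q⇒x∉q {p = D})
      (λ d∈D─S → IsNeighborhoodClass⇒Twins {G = G} D-class s∈D (p─q⊆p D S d∈D─S)) closed
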